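{- Let $\lambda$ be a partition and $n$ a positive integer. If a partition $\rho$ satisfies $(\lambda_1)\subseteq\rho\subseteq\bar\lambda^{(n)}$, then there exists a highest weight element $T\in\mathrm{SVRPP}^n(\lambda)$ with $\mathrm{ircont}(T)=\rho$.
   Context: Boxes are $(i,j)$ (row $i$, column $j$); for partitions, $\rho\subseteq\nu$ means $\rho_i\le\nu_i$ for all $i$, and $(\lambda_1)$ is the one-part partition. $\mathrm{SVRPP}^n(\lambda)$: fillings $T$ of the Young diagram of $\lambda$ by nonempty subsets $T(i,j)\subseteq[n]$ weakly increasing along rows and down columns ($A\le B$ meaning $\max A\le\min B$); $\mathrm{ircont}(T)=(r_1,\ldots,r_n)$, $r_k$ = number of columns containing a box whose set contains $k$. Highest weight: for $m\in[n-1]$, restrict $T$ to the boxes whose set meets $\{m,m+1\}$; a nonempty column of this restriction is $m$-pure if each of its boxes meets $\{m,m+1\}$ in exactly $\{m\}$, $(m+1)$-pure if exactly $\{m+1\}$, mixed otherwise; the $m$-signature lists, columns left to right, $+$ for $m$-pure and $-$ for $(m+1)$-pure columns; repeatedly cancel a $-$ immediately followed by a $+$. $T$ is highest weight if for every $m$ no $-$ survives. Define $\lambda^\flat$ by $\lambda^\flat_1=\lambda_1$ and $\lambda^\flat_i=\max\{0,\min\{\lambda^\flat_{i-1}-1,\lambda_i\}\}$ for $i\ge2$; let $k$ be its number of positive parts. $\bar\lambda^{(n)}=(\bar\lambda^{(n)}_1,\ldots,\bar\lambda^{(n)}_n)$: if $n\le k$, $\bar\lambda^{(n)}_i=\lambda^\flat_i+i-1$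 for $i\le n$; if $n>k$, $\bar\lambda^{(n)}_i=\lambda^\flat_i+i-1$ for $i\le k$ and $\bar\lambda^{(n)}_i=k$ for $k<i\le n$. -}

module Defs where

open import Data.Nat using (ℕ; zero; suc; _+_; _∸_; _⊓_; _≤_; _<_; _<ᵇ_)
open import Data.Bool using (Bool; true; false; _∧_; _∨_; not; if_then_else_)
open import Data.List using (List; []; _∷_; _++_; length; map; upTo; concatMap)
open import Data.List.Relation.Unary.All using (All)
open import Data.List.Relation.Unary.Linked using (Linked)
open import Data.List.Membership.Propositional using (_∉_)
open import Data.Fin.Subset using (Subset)
open import Data.Vec using ([]; _∷_)
open import Data.Product using (Σ; _×_; ∃)
open import Relation.Binary.PropositionalEquality using (_≡_)
open import Relation.Binary.Construct.Closure.ReflexiveTransitive using (Star)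
open import Relation.Nullary using (¬_)

-- Conventions: everything is 0-indexed.  Row i / column j / letter k of
-- the paper correspond to i-1 / j-1 / k-1 here.  [n] = {0,…,n-1}.

_‼_ : List ℕ → ℕ → ℕ
[] ‼ i = 0
(x ∷ xs) ‼ zero = x
(x ∷ xs) ‼ suc i = xs ‼ i

record IsPartition (p : List ℕ) : Set where
  field
    decreasing : Linked (λ a b → b ≤ a) p
    positive   : All (λ a → 0 < a) p

_⊆P_ : List ℕ → List ℕ → Set
r ⊆P v = ∀ i → r ‼ i ≤ v ‼ i

countB : (ℕ → Bool) → ℕ → ℕ
countB f zero = 0
countB f (suc N) = countB f N + (if f N then 1 else 0)

anyB : (ℕ → Bool) → ℕ → Bool
anyB f zero = false
anyB f (suc N) = anyB f N ∨ f N

allB : (ℕ → Bool) → ℕ → Bool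
allB f zero = true
allB f (suc N) = allB f N ∧ f N

has : ∀ {n} → Subset n → ℕ → Bool
has [] k = false
has (b ∷ s) zero = b
has (b ∷ s) (suc k) = has s k

-- a filling assigns a subset of [n] to each box (i , j);
-- only the boxes of the Young diagram matter
Filling : ℕ → Set
Filling n = ℕ → ℕ → Subset n

InDiagram : List ℕ → ℕ → ℕ → Set
InDiagram lam i j = j < lam ‼ i

SetNonempty : ∀ {n} → Subset n → Set
SetNonempty A = ∃ λ a → has A a ≡ true

_≤S_ : ∀ {n} → Subset n → Subset n → Set
A ≤S B = ∀ a b → has A a ≡ true → has B b ≡ true → a ≤ b

IsSVRPP : (n : ℕ) → List ℕ → Filling n → Set
IsSVRPP n lam T =
  (∀ i j → InDiagram lam i j → SetNonempty (T i j)) ×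
  (∀ i j → InDiagram lam i (suc j) → T i j ≤S T i (suc j)) ×
  (∀ i j → InDiagram lam (suc i) j → T i j ≤S T (suc i) j)

colHas : ∀ {n} → List ℕ → Filling n → ℕ → ℕ → Bool
colHas lam T k j = anyB (λ i → (j <ᵇ lam ‼ i) ∧ has (T i j) k) (length lam)

ircont : ∀ {n} → List ℕ → Filling n → ℕ → ℕ
ircont lam T k = countB (colHas lam T k) (lam ‼ 0)

data Sign : Set where
  plus minus : Sign

module _ {n : ℕ} (lam : List ℕ) (T : Filling n) (m : ℕ) (j : ℕ) where
  meets : ℕ → Bool
  meets i = (j <ᵇ lam ‼ i) ∧ (has (T i j) m ∨ has (T i j) (suc m))

  colNonempty : Bool
  colNonempty = anyB meets (length lam)

  mPure : Bool
  mPure = colNonempty ∧ allB (λ i → not (meets i) ∨ (has (T i j) m ∧ not (has (T i j) (suc m)))) (length lam)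

  m1Pure : Bool
  m1Pure = colNonempty ∧ allB (λ i → not (meets i) ∨ (has (T i j) (suc m) ∧ not (has (T i j) m))) (length lam)

  colSign : List Sign
  colSign = if mPure then plus ∷ [] else (if m1Pure then minus ∷ [] else [])

signature : ∀ {n} → List ℕ → Filling n → ℕ → List Sign
signature lam T m = concatMap (colSign lam T m) (upTo (lam ‼ 0))

data CancelStep : List Sign → List Sign → Set where
  cancel : ∀ xs ys → CancelStep (xs ++ minus ∷ plus ∷ ys) (xs ++ ys)

Irreducible : List Sign → Set
Irreducible w = ∀ w' → ¬ CancelStep w w'

IsHighestWeight : (n : ℕ) → List ℕ → Filling n → Set
IsHighestWeight n lam T =
  ∀ m → suc m < n →
  ∀ w → Star CancelStep (signature lam T m) w → Irreducible w → minus ∉ w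

flatAt : List ℕ → ℕ → ℕ
flatAt lam zero = lam ‼ 0
flatAt lam (suc i) = (flatAt lam i ∸ 1) ⊓ (lam ‼ suc i)

flat : List ℕ → List ℕ
flat lam = map (flatAt lam) (upTo (length lam))

flatLen : List ℕ → ℕ
flatLen lam = countB (λ i → 0 <ᵇ flatAt lam i) (length lam)

barAt : ℕ → List ℕ → ℕ → ℕ
barAt n lam i = if i <ᵇ flatLen lam then flatAt lam i + i else flatLen lam

bar : ℕ → List ℕ → List ℕ
bar n lam = map (barAt n lam) (upTo n)

{-# OPTIONS --safe #-}
module Submission where

-- Write f = λ♭ and ρ′ for the conjugate of ρ.  Row i of λ♭ gets the letter i in its last
-- ρ_i − i columns, its segment: ρ ⊆ λ̄ says exactly that these fit, and ρ_0 = λ_0 makes all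
-- of row 0 a segment.  Every other box of λ♭ repeats the letter of the nearest segment above
-- it; the last box of row r of λ♭ also gets the letters ℓ with r < ℓ < ρ′_r, and the boxes
-- of λ below λ♭ repeat the largest letter of the last box above them.  Letter ℓ then occurs
-- in the ρ_ℓ − ℓ columns of its segment and in the last columns of the rows r < min(ℓ, ρ_ℓ),
-- that is, in ρ_ℓ columns.  In the m-signature the (m+1)-pure columns lie in segment m+1,
-- left of segment m and of column f_{m+1}; from column f_{m+1} on, the columns of segment m
-- other than its last are m-pure, and as ρ_{m+1} − (m+1) < ρ_m − m they are at least as
-- many, so every − is cancelled.

open import Defs
open import Data.Bool using (Bool; true; false; _∧_; _∨_; not; if_then_else_; T)
open import Data.Bool.Properties using (T?; T-∧; T-∨; T-≡; T-not-≡; ∧-identityʳ)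
open import Data.Fin using (toℕ)
open import Data.List using (List; []; _∷_; _++_; length; map; applyUpTo; upTo; concatMap)
open import Data.List.Properties using (upTo-∷ʳ; concatMap-++; ++-identityʳ)
open import Data.List.Membership.Propositional using (_∈_; _∉_)
open import Data.List.Relation.Unary.Any using (here; there)
open import Data.List.Relation.Unary.Linked using (Linked; []; [-]; _∷_)
open import Data.Nat
open import Data.Nat.Properties
open import Algebra.Properties.CommutativeSemigroup +-commutativeSemigroup using (interchange)
open import Data.Product using (Σ; _×_; _,_; proj₁; proj₂; ∃-syntax)
open import Data.Sum using (_⊎_; inj₁; inj₂; [_,_]′)
open import Data.Vec using (tabulate)
open import Function using (_∘_; id)
open import Function.Bundles using (_⇔_; mk⇔; Equivalence)
open import Relation.Binary.Construct.Closure.ReflexiveTransitive using (Star; ε; _◅_)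
open import Relation.Binary.Definitions using (tri<; tri≈; tri>)
open import Relation.Binary.PropositionalEquality
open import Relation.Nullary using (¬_; Dec; yes; no; contradiction)

open Equivalence using (to; from)

indicator : Bool → ℕ
indicator b = if b then 1 else 0

if-true : ∀ {A : Set} {b} {x y : A} → T b → (if b then x else y) ≡ x
if-true {b = true} _ = refl

if-false : ∀ {A : Set} {b} {x y : A} → ¬ T b → (if b then x else y) ≡ y
if-false {b = true} ¬b = contradiction _ ¬b
if-false {b = false} _ = refl

¬T⇒≡false : ∀ {b} → ¬ T b → b ≡ false
¬T⇒≡false {true} ¬b = contradiction _ ¬b
¬T⇒≡false {false} _ = refl

T-extensional : ∀ {a b} → (T a → T b) → (T b → T a) → a ≡ b
T-extensional {true} {true} _ _ = refl
T-extensional {true} {false} a⇒b _ = contradiction (a⇒b _) λ ()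
T-extensional {false} {true} _ b⇒a = contradiction (b⇒a _) λ ()
T-extensional {false} {false} _ _ = refl

T-not⁺ : ∀ {b} → ¬ T b → T (not b)
T-not⁺ = from T-not-≡ ∘ ¬T⇒≡false

T-not⁻ : ∀ {b} → T (not b) → ¬ T b
T-not⁻ {true} () _

indicator≤1 : ∀ b → indicator b ≤ 1
indicator≤1 true = ≤-refl
indicator≤1 false = z≤n

indicator-mono : ∀ {a b} → (T a → T b) → indicator a ≤ indicator b
indicator-mono {true} a⇒b = ≤-reflexive (sym (if-true (a⇒b _)))
indicator-mono {false} _ = z≤n

indicator-∨ : ∀ {a b} → (T a → ¬ T b) → indicator (a ∨ b) ≡ indicator a + indicator b
indicator-∨ {true} {b} disjoint = cong suc (sym (if-false (disjoint _)))
indicator-∨ {false} _ = refl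

DownClosed : (ℕ → Bool) → Set
DownClosed p = ∀ i → T (p (suc i)) → T (p i)

downClosed-≤ : ∀ {p} → DownClosed p → ∀ {i j} → i ≤ j → T (p j) → T (p i)
downClosed-≤ {p} closed = go ∘ ≤⇒≤′
  where
  go : ∀ {i j} → i ≤′ j → T (p j) → T (p i)
  go ≤′-refl = id
  go (≤′-step i≤′j) = go i≤′j ∘ closed _

antitone-by-steps : ∀ (h : ℕ → ℕ) → (∀ i → h (suc i) ≤ h i) → ∀ {i j} → i ≤ j → h j ≤ h i
antitone-by-steps h step = go ∘ ≤⇒≤′
  where
  go : ∀ {i j} → i ≤′ j → h j ≤ h i
  go ≤′-refl = ≤-refl
  go (≤′-step i≤′j) = ≤-trans (step _) (go i≤′j)

module _ (p : ℕ → Bool) where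

  anyB⁺ : ∀ {N i} → i < N → T (p i) → T (anyB p N)
  anyB⁺ {suc N} i<N pi with m<1+n⇒m<n∨m≡n i<N
  ... | inj₁ i<N' = from T-∨ (inj₁ (anyB⁺ i<N' pi))
  ... | inj₂ refl = from T-∨ (inj₂ pi)

  anyB⁻ : ∀ {N} → T (anyB p N) → ∃[ i ] i < N × T (p i)
  anyB⁻ {suc N} h with to T-∨ h
  ... | inj₁ h' = let i , i<N , pi = anyB⁻ h' in i , m<n⇒m<1+n i<N , pi
  ... | inj₂ pN = N , n<1+n N , pN

  allB⁺ : ∀ {N} → (∀ {i} → i < N → T (p i)) → T (allB p N)
  allB⁺ {zero} _ = _
  allB⁺ {suc N} all = from T-∧ (allB⁺ (all ∘ m<n⇒m<1+n) , all (n<1+n N))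

  allB⁻ : ∀ {N i} → T (allB p N) → i < N → T (p i)
  allB⁻ {suc N} h i<N with m<1+n⇒m<n∨m≡n i<N
  ... | inj₁ i<N' = allB⁻ (proj₁ (to T-∧ h)) i<N'
  ... | inj₂ refl = proj₂ (to T-∧ h)

  countB≤ : ∀ N → countB p N ≤ N
  countB≤ zero = z≤n
  countB≤ (suc N) = ≤-trans (+-mono-≤ (countB≤ N) (indicator≤1 (p N))) (≤-reflexive (+-comm N 1))

  countB-monoʳ : ∀ {M N} → M ≤ N → countB p M ≤ countB p N
  countB-monoʳ = go ∘ ≤⇒≤′
    where
    go : ∀ {M N} → M ≤′ N → countB p M ≤ countB p N
    go ≤′-refl = ≤-refl
    go (≤′-step M≤′N) = ≤-trans (go M≤′N) (m≤m+n _ _)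

  countB-none : ∀ N → (∀ {i} → i < N → ¬ T (p i)) → countB p N ≡ 0
  countB-none zero _ = refl
  countB-none (suc N) none =
    cong₂ _+_ (countB-none N (none ∘ m<n⇒m<1+n)) (if-false (none (n<1+n N)))

  countB-all : ∀ N → (∀ {i} → i < N → T (p i)) → countB p N ≡ N
  countB-all zero _ = refl
  countB-all (suc N) all =
    trans (cong₂ _+_ (countB-all N (all ∘ m<n⇒m<1+n)) (if-true (all (n<1+n N)))) (+-comm N 1)

  countB-downClosed⁻ : DownClosed p → ∀ {N r} → r < countB p N → T (p r)
  countB-downClosed⁻ closed {N} {r} r<count with T? (p r)
  ... | yes pr = pr
  ... | no ¬pr = contradiction (<-≤-trans r<count (bounded N)) (<-irrefl refl)
    where
    bounded : ∀ N → countB p N ≤ r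
    bounded zero = z≤n
    bounded (suc N) with N <? r
    ... | yes N<r = ≤-trans (countB≤ (suc N)) N<r
    ... | no N≮r = ≤-trans (≤-reflexive (trans (cong (countB p N +_) (if-false ¬pN)) (+-identityʳ _)))
                           (bounded N)
      where
      ¬pN : ¬ T (p N)
      ¬pN = ¬pr ∘ downClosed-≤ closed (≮⇒≥ N≮r)

  countB-downClosed⁺ : DownClosed p → ∀ {N r} → r < N → T (p r) → r < countB p N
  countB-downClosed⁺ closed {N} {r} r<N pr = begin-strict
    r                  <⟨ n<1+n r ⟩
    suc r              ≡⟨ sym (countB-all (suc r) (λ i≤r → downClosed-≤ closed (s≤s⁻¹ i≤r) pr)) ⟩
    countB p (suc r)   ≤⟨ countB-monoʳ r<N ⟩
    countB p N         ∎
    where open ≤-Reasoning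

module _ (p q : ℕ → Bool) where

  countB-cong : ∀ N → (∀ {i} → i < N → p i ≡ q i) → countB p N ≡ countB q N
  countB-cong zero _ = refl
  countB-cong (suc N) eq = cong₂ _+_ (countB-cong N (eq ∘ m<n⇒m<1+n)) (cong indicator (eq (n<1+n N)))

  countB-mono : ∀ N → (∀ {i} → i < N → T (p i) → T (q i)) → countB p N ≤ countB q N
  countB-mono zero _ = z≤n
  countB-mono (suc N) p⇒q =
    +-mono-≤ (countB-mono N (p⇒q ∘ m<n⇒m<1+n)) (indicator-mono (p⇒q (n<1+n N)))

  countB-∨ : ∀ N → (∀ {i} → i < N → T (p i) → ¬ T (q i)) →
             countB (λ i → p i ∨ q i) N ≡ countB p N + countB q N
  countB-∨ zero _ = refl
  countB-∨ (suc N) disjoint = trans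
    (cong₂ _+_ (countB-∨ N (disjoint ∘ m<n⇒m<1+n)) (indicator-∨ (disjoint (n<1+n N))))
    (interchange (countB p N) (countB q N) (indicator (p N)) (indicator (q N)))

countB-interval : ∀ a b N → countB (λ j → (a ≤ᵇ j) ∧ (j <ᵇ b)) N ≡ (b ⊓ N) ∸ a
countB-interval a b zero = sym (trans (cong (_∸ a) (⊓-zeroʳ b)) (0∸n≡0 a))
countB-interval a b (suc N) with N <? b
... | yes N<b = begin
  countB _ N + indicator ((a ≤ᵇ N) ∧ (N <ᵇ b))
    ≡⟨ cong₂ _+_ (countB-interval a b N) (cong indicator drop-N<b) ⟩
  (b ⊓ N) ∸ a + indicator (a ≤ᵇ N)
    ≡⟨ cong (λ x → x ∸ a + indicator (a ≤ᵇ N)) (m≥n⇒m⊓n≡n (<⇒≤ N<b)) ⟩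
  N ∸ a + indicator (a ≤ᵇ N)
    ≡⟨ ∸-+-indicator ⟩
  suc N ∸ a
    ≡⟨ cong (_∸ a) (sym (m≥n⇒m⊓n≡n N<b)) ⟩
  (b ⊓ suc N) ∸ a ∎
  where
  open ≡-Reasoning
  drop-N<b : (a ≤ᵇ N) ∧ (N <ᵇ b) ≡ (a ≤ᵇ N)
  drop-N<b = trans (cong ((a ≤ᵇ N) ∧_) (to T-≡ (<⇒<ᵇ N<b))) (∧-identityʳ (a ≤ᵇ N))
  ∸-+-indicator : N ∸ a + indicator (a ≤ᵇ N) ≡ suc N ∸ a
  ∸-+-indicator with a ≤? N
  ... | yes a≤N = begin
    N ∸ a + indicator (a ≤ᵇ N)  ≡⟨ cong (N ∸ a +_) (if-true (≤⇒≤ᵇ a≤N)) ⟩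
    N ∸ a + 1                   ≡⟨ +-comm (N ∸ a) 1 ⟩
    suc (N ∸ a)                 ≡⟨ sym (+-∸-assoc 1 a≤N) ⟩
    suc N ∸ a                   ∎
  ... | no a≰N = begin
    N ∸ a + indicator (a ≤ᵇ N)
      ≡⟨ cong₂ _+_ (m≤n⇒m∸n≡0 (<⇒≤ (≰⇒> a≰N))) (if-false (a≰N ∘ ≤ᵇ⇒≤ a N)) ⟩
    0
      ≡⟨ sym (m≤n⇒m∸n≡0 (≰⇒> a≰N)) ⟩
    suc N ∸ a ∎
... | no N≮b = begin
  countB _ N + indicator ((a ≤ᵇ N) ∧ (N <ᵇ b))
    ≡⟨ cong₂ _+_ (countB-interval a b N) (if-false {b = (a ≤ᵇ N) ∧ (N <ᵇ b)} (N≮b ∘ N<b)) ⟩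
  (b ⊓ N) ∸ a + 0
    ≡⟨ +-identityʳ _ ⟩
  (b ⊓ N) ∸ a
    ≡⟨ cong (_∸ a) (trans (m≤n⇒m⊓n≡m b≤N) (sym (m≤n⇒m⊓n≡m (m≤n⇒m≤1+n b≤N)))) ⟩
  (b ⊓ suc N) ∸ a ∎
  where
  open ≡-Reasoning
  b≤N : b ≤ N
  b≤N = ≮⇒≥ N≮b
  N<b : T ((a ≤ᵇ N) ∧ (N <ᵇ b)) → N < b
  N<b = <ᵇ⇒< N b ∘ proj₂ ∘ to T-∧

countB-interval≤ : ∀ a {b N} → b ≤ N → countB (λ j → (a ≤ᵇ j) ∧ (j <ᵇ b)) N ≡ b ∸ a
countB-interval≤ a {b} {N} b≤N = trans (countB-interval a b N) (cong (_∸ a) (m≤n⇒m⊓n≡m b≤N))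

countB-≡ᵇ : ∀ {c N} → c < N → countB (c ≡ᵇ_) N ≡ 1
countB-≡ᵇ {c} {suc N} c<1+N with m<1+n⇒m<n∨m≡n c<1+N
... | inj₁ c<N = cong₂ _+_ (countB-≡ᵇ c<N) (if-false (<⇒≢ c<N ∘ ≡ᵇ⇒≡ c N))
... | inj₂ refl =
  cong₂ _+_ (countB-none (c ≡ᵇ_) c (λ j<c → <⇒≢ j<c ∘ sym ∘ ≡ᵇ⇒≡ c _)) (if-true (≡⇒≡ᵇ c c refl))

countB-image : ∀ (h : ℕ → ℕ) x N → (∀ {r} → r < x → 0 < h r × h r ≤ N) →
  (∀ {r r'} → r < x → r' < x → h r ≡ h r' → r ≡ r') →
  countB (λ j → anyB (λ r → h r ≡ᵇ suc j) x) N ≡ x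
countB-image h zero N _ _ = countB-none _ N (λ _ ())
countB-image h (suc x) N range injective = begin
  countB (λ j → anyB (λ r → h r ≡ᵇ suc j) x ∨ (h x ≡ᵇ suc j)) N
    ≡⟨ countB-∨ _ _ N disjoint ⟩
  countB (λ j → anyB (λ r → h r ≡ᵇ suc j) x) N + countB (λ j → h x ≡ᵇ suc j) N
    ≡⟨ cong₂ _+_ (countB-image h x N (range ∘ m<n⇒m<1+n) (λ r<x → injective (m<n⇒m<1+n r<x) ∘ m<n⇒m<1+n))
                 (last (h x) (range (n<1+n x))) ⟩
  x + 1
    ≡⟨ +-comm x 1 ⟩
  suc x ∎
  where
  open ≡-Reasoning
  last : ∀ c → 0 < c × c ≤ N → countB (λ j → c ≡ᵇ suc j) N ≡ 1
  last (suc c) (_ , c<N) = countB-≡ᵇ c<N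
  disjoint : ∀ {j} → j < N → T (anyB (λ r → h r ≡ᵇ suc j) x) → ¬ T (h x ≡ᵇ suc j)
  disjoint {j} _ earlier hx≡1+j =
    let r , r<x , hr≡1+j = anyB⁻ _ earlier
    in <⇒≢ r<x (injective (m<n⇒m<1+n r<x) (n<1+n x)
                          (trans (≡ᵇ⇒≡ _ _ hr≡1+j) (sym (≡ᵇ⇒≡ _ _ hx≡1+j))))

linked-‼-suc≤ : ∀ {p} → Linked (λ a b → b ≤ a) p → ∀ i → p ‼ suc i ≤ p ‼ i
linked-‼-suc≤ [] _ = z≤n
linked-‼-suc≤ [-] _ = z≤n
linked-‼-suc≤ (b≤a ∷ _) zero = b≤a
linked-‼-suc≤ (_ ∷ linked) (suc i) = linked-‼-suc≤ linked i

partition-antitone : ∀ {p} → IsPartition p → ∀ {i j} → i ≤ j → p ‼ j ≤ p ‼ i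
partition-antitone {p} isPartition =
  antitone-by-steps (p ‼_) (linked-‼-suc≤ (IsPartition.decreasing isPartition))

‼-positive⇒<length : ∀ p {i} → 0 < p ‼ i → i < length p
‼-positive⇒<length (_ ∷ _) {zero} _ = z<s
‼-positive⇒<length (_ ∷ p) {suc i} pos = s<s (‼-positive⇒<length p pos)

‼-map-applyUpTo : ∀ (h g : ℕ → ℕ) {n i} → i < n → map h (applyUpTo g n) ‼ i ≡ h (g i)
‼-map-applyUpTo h g {suc n} {zero} _ = refl
‼-map-applyUpTo h g {suc n} {suc i} i<n = ‼-map-applyUpTo h (g ∘ suc) (s<s⁻¹ i<n)

‼-map-applyUpTo-≥ : ∀ (h g : ℕ → ℕ) {n i} → n ≤ i → map h (applyUpTo g n) ‼ i ≡ 0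
‼-map-applyUpTo-≥ h g {zero} _ = refl
‼-map-applyUpTo-≥ h g {suc n} {suc i} n≤i = ‼-map-applyUpTo-≥ h (g ∘ suc) (s≤s⁻¹ n≤i)

has-tabulate : ∀ n (p : ℕ → Bool) k → has (tabulate {n = n} (p ∘ toℕ)) k ≡ (k <ᵇ n) ∧ p k
has-tabulate zero p k = refl
has-tabulate (suc n) p zero = refl
has-tabulate (suc n) p (suc k) = has-tabulate n (p ∘ suc) k

-- The number of − left uncancelled after reading w, when q of them precede w.
pending : ℕ → List Sign → ℕ
pending q [] = q
pending q (plus ∷ w) = pending (pred q) w
pending q (minus ∷ w) = pending (suc q) w

pending-++ : ∀ q u v → pending q (u ++ v) ≡ pending (pending q u) v
pending-++ q [] v = refl
pending-++ q (plus ∷ u) v = pending-++ (pred q) u v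
pending-++ q (minus ∷ u) v = pending-++ (suc q) u v

pending-cancel : ∀ q {w w'} → Star CancelStep w w' → pending q w ≡ pending q w'
pending-cancel q ε = refl
pending-cancel q (cancel u v ◅ steps) =
  trans (trans (pending-++ q u _) (sym (pending-++ q u v))) (pending-cancel q steps)

irreducible-∷ : ∀ {x w} → Irreducible (x ∷ w) → Irreducible w
irreducible-∷ {x} irreducible _ (cancel u v) = irreducible _ (cancel (x ∷ u) v)

irreducible-minus⇒pending>0 : ∀ q {w} → Irreducible w → minus ∈ w → 0 < pending q w
irreducible-minus⇒pending>0 q {minus ∷ []} _ _ = z<s
irreducible-minus⇒pending>0 q {minus ∷ plus ∷ w} irreducible _ =
  contradiction (cancel [] w) (irreducible w)
irreducible-minus⇒pending>0 q {minus ∷ minus ∷ w} irreducible _ =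
  irreducible-minus⇒pending>0 (suc q) (irreducible-∷ irreducible) (here refl)
irreducible-minus⇒pending>0 q {plus ∷ w} irreducible (there minus∈w) =
  irreducible-minus⇒pending>0 (pred q) (irreducible-∷ irreducible) minus∈w

pending≡0⇒minus∉ : ∀ {w} → pending 0 w ≡ 0 →
                   ∀ w' → Star CancelStep w w' → Irreducible w' → minus ∉ w'
pending≡0⇒minus∉ pending≡0 w' steps irreducible minus∈w' =
  <⇒≢ (irreducible-minus⇒pending>0 0 irreducible minus∈w')
      (sym (trans (sym (pending-cancel 0 steps)) pending≡0))

module ColumnSigns (P M : ℕ → Bool) where

  columnSign : ℕ → List Sign
  columnSign j = if P j then plus ∷ [] else (if M j then minus ∷ [] else [])

  minusColumn : ℕ → Bool
  minusColumn j = not (P j) ∧ M j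

  plusColumnFrom : ℕ → ℕ → Bool
  plusColumnFrom F j = (F ≤ᵇ j) ∧ P j

  minusColumn⁺ : ∀ {j} → ¬ T (P j) → T (M j) → T (minusColumn j)
  minusColumn⁺ ¬pj mj = from T-∧ (T-not⁺ ¬pj , mj)

  minusColumn⇒M : ∀ {j} → T (minusColumn j) → T (M j)
  minusColumn⇒M {j} = proj₂ ∘ to (T-∧ {not (P j)})

  pendingUpTo : ℕ → ℕ
  pendingUpTo N = pending 0 (concatMap columnSign (upTo N))

  pendingUpTo-suc : ∀ N → pendingUpTo (suc N) ≡ pending (pendingUpTo N) (columnSign N)
  pendingUpTo-suc N = begin
    pending 0 (concatMap columnSign (upTo (suc N)))
      ≡⟨ cong (pending 0 ∘ concatMap columnSign) (sym (upTo-∷ʳ N)) ⟩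
    pending 0 (concatMap columnSign (upTo N ++ N ∷ []))
      ≡⟨ cong (pending 0) (concatMap-++ columnSign (upTo N) (N ∷ [])) ⟩
    pending 0 (concatMap columnSign (upTo N) ++ columnSign N ++ [])
      ≡⟨ pending-++ 0 (concatMap columnSign (upTo N)) _ ⟩
    pending (pendingUpTo N) (columnSign N ++ [])
      ≡⟨ cong (pending (pendingUpTo N)) (++-identityʳ (columnSign N)) ⟩
    pending (pendingUpTo N) (columnSign N) ∎
    where open ≡-Reasoning

  pendingUpTo-plus : ∀ {N} → T (P N) → pendingUpTo (suc N) ≡ pred (pendingUpTo N)
  pendingUpTo-plus {N} pN = trans (pendingUpTo-suc N) (cong (pending (pendingUpTo N)) (if-true pN))

  pendingUpTo-minus : ∀ {N} → ¬ T (P N) → T (M N) → pendingUpTo (suc N) ≡ suc (pendingUpTo N)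
  pendingUpTo-minus {N} ¬pN mN =
    trans (pendingUpTo-suc N) (cong (pending (pendingUpTo N)) (trans (if-false ¬pN) (if-true mN)))

  pendingUpTo-blank : ∀ {N} → ¬ T (P N) → ¬ T (M N) → pendingUpTo (suc N) ≡ pendingUpTo N
  pendingUpTo-blank {N} ¬pN ¬mN =
    trans (pendingUpTo-suc N) (cong (pending (pendingUpTo N)) (trans (if-false ¬pN) (if-false ¬mN)))

  pendingUpTo≤minusCount : ∀ N → pendingUpTo N ≤ countB minusColumn N
  pendingUpTo≤minusCount zero = z≤n
  pendingUpTo≤minusCount (suc N) with T? (P N) | T? (M N)
  ... | yes pN | _ = begin
    pendingUpTo (suc N)       ≡⟨ pendingUpTo-plus pN ⟩
    pred (pendingUpTo N)      ≤⟨ pred[n]≤n ⟩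
    pendingUpTo N             ≤⟨ pendingUpTo≤minusCount N ⟩
    countB minusColumn N      ≤⟨ m≤m+n _ _ ⟩
    countB minusColumn (suc N) ∎
    where open ≤-Reasoning
  ... | no ¬pN | yes mN = begin
    pendingUpTo (suc N)       ≡⟨ pendingUpTo-minus ¬pN mN ⟩
    suc (pendingUpTo N)       ≤⟨ s≤s (pendingUpTo≤minusCount N) ⟩
    suc (countB minusColumn N) ≡⟨ +-comm 1 _ ⟩
    countB minusColumn N + 1  ≡⟨ cong (countB minusColumn N +_) (sym (if-true (minusColumn⁺ ¬pN mN))) ⟩
    countB minusColumn (suc N) ∎
    where open ≤-Reasoning
  ... | no ¬pN | no ¬mN = begin
    pendingUpTo (suc N)       ≡⟨ pendingUpTo-blank ¬pN ¬mN ⟩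
    pendingUpTo N             ≤⟨ pendingUpTo≤minusCount N ⟩
    countB minusColumn N      ≤⟨ m≤m+n _ _ ⟩
    countB minusColumn (suc N) ∎
    where open ≤-Reasoning

  pendingUpTo-tail : ∀ {F N} → F ≤′ N → (∀ {j} → F ≤ j → j < N → ¬ T (minusColumn j)) →
                     pendingUpTo N ≤ pendingUpTo F ∸ countB (plusColumnFrom F) N
  pendingUpTo-tail {F} ≤′-refl _ = ≤-reflexive (cong (pendingUpTo F ∸_) (sym (countB-none _ F none)))
    where
    none : ∀ {j} → j < F → ¬ T (plusColumnFrom F j)
    none j<F = <⇒≱ j<F ∘ ≤ᵇ⇒≤ F _ ∘ proj₁ ∘ to T-∧
  pendingUpTo-tail {F} {suc N} (≤′-step F≤′N) noMinus with T? (P N) | T? (M N)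
  ... | yes pN | _ = begin
    pendingUpTo (suc N)                      ≡⟨ pendingUpTo-plus pN ⟩
    pred (pendingUpTo N)                     ≤⟨ pred-mono-≤ (pendingUpTo-tail F≤′N (λ F≤j → noMinus F≤j ∘ m<n⇒m<1+n)) ⟩
    pred (pendingUpTo F ∸ countB plusFrom N) ≡⟨ pred[m∸n]≡m∸[1+n] (pendingUpTo F) _ ⟩
    pendingUpTo F ∸ suc (countB plusFrom N)  ≡⟨ cong (pendingUpTo F ∸_) count≡ ⟩
    pendingUpTo F ∸ countB plusFrom (suc N)  ∎
    where
    open ≤-Reasoning
    plusFrom = plusColumnFrom F
    count≡ : suc (countB plusFrom N) ≡ countB plusFrom (suc N)
    count≡ = trans (+-comm 1 _) (cong (countB plusFrom N +_) (sym (if-true plusN)))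
      where
      plusN = from T-∧ (≤⇒≤ᵇ (≤′⇒≤ F≤′N) , pN)
  ... | no ¬pN | yes mN = contradiction (minusColumn⁺ ¬pN mN) (noMinus (≤′⇒≤ F≤′N) (n<1+n N))
  ... | no ¬pN | no ¬mN = begin
    pendingUpTo (suc N)                      ≡⟨ pendingUpTo-blank ¬pN ¬mN ⟩
    pendingUpTo N                            ≤⟨ pendingUpTo-tail F≤′N (λ F≤j → noMinus F≤j ∘ m<n⇒m<1+n) ⟩
    pendingUpTo F ∸ countB plusFrom N        ≡⟨ cong (pendingUpTo F ∸_) count≡ ⟩
    pendingUpTo F ∸ countB plusFrom (suc N)  ∎
    where
    open ≤-Reasoning
    plusFrom = plusColumnFrom F
    count≡ : countB plusFrom N ≡ countB plusFrom (suc N)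
    count≡ = trans (sym (+-identityʳ _)) (cong (countB plusFrom N +_) (sym (if-false ¬plusN)))
      where
      ¬plusN = ¬pN ∘ proj₂ ∘ to (T-∧ {F ≤ᵇ N})

  pendingUpTo≡0 : ∀ {F N} → F ≤ N → (∀ {j} → F ≤ j → j < N → ¬ T (minusColumn j)) →
                  countB minusColumn F ≤ countB (plusColumnFrom F) N → pendingUpTo N ≡ 0
  pendingUpTo≡0 {F} {N} F≤N noMinus enoughPlus = n≤0⇒n≡0 (begin
    pendingUpTo N                            ≤⟨ pendingUpTo-tail (≤⇒≤′ F≤N) noMinus ⟩
    pendingUpTo F ∸ countB plusFrom N        ≤⟨ ∸-monoˡ-≤ (countB plusFrom N) (pendingUpTo≤minusCount F) ⟩
    countB minusColumn F ∸ countB plusFrom N ≡⟨ m≤n⇒m∸n≡0 enoughPlus ⟩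
    0                                        ∎)
    where
    open ≤-Reasoning
    plusFrom = plusColumnFrom F

module _ {n} (lam : List ℕ) (S : Filling n) (m j : ℕ) where

  private
    N = length lam

    boxHas : ℕ → ℕ → Bool
    boxHas k i = (j <ᵇ lam ‼ i) ∧ has (S i j) k

    pure-at : ∀ (X : ℕ → Bool) {i} → T (allB (λ i → not (meets lam S m j i) ∨ X i) N) →
              i < N → T (meets lam S m j i) → T (X i)
    pure-at X all i<N meets-i with to T-∨ (allB⁻ (λ i → not (meets lam S m j i) ∨ X i) all i<N)
    ... | inj₁ ¬meets-i = contradiction meets-i (T-not⁻ ¬meets-i)
    ... | inj₂ Xi = Xi

  m1Pure⇒colHas : T (m1Pure lam S m j) → T (colHas lam S (suc m) j) × ¬ T (colHas lam S m j)
  m1Pure⇒colHas pure = has-1+m , ¬has-m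
    where
    nonempty = proj₁ (to (T-∧ {colNonempty lam S m j}) pure)
    all = proj₂ (to (T-∧ {colNonempty lam S m j}) pure)
    has-1+m : T (colHas lam S (suc m) j)
    has-1+m with anyB⁻ (meets lam S m j) {N} nonempty
    ... | i , i<N , meets-i = anyB⁺ (boxHas (suc m)) i<N (from T-∧
      ( proj₁ (to (T-∧ {j <ᵇ lam ‼ i}) meets-i)
      , proj₁ (to (T-∧ {has (S i j) (suc m)}) (pure-at _ all i<N meets-i))))
    ¬has-m : ¬ T (colHas lam S m j)
    ¬has-m h with anyB⁻ (boxHas m) {N} h
    ... | i , i<N , box-has-m =
      let j<λi , has-m = to (T-∧ {j <ᵇ lam ‼ i}) box-has-m
          meets-i = from (T-∧ {j <ᵇ lam ‼ i}) (j<λi , from (T-∨ {has (S i j) m}) (inj₁ has-m))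
      in T-not⁻ (proj₂ (to (T-∧ {has (S i j) (suc m)}) (pure-at _ all i<N meets-i))) has-m

  colHas⇒mPure : T (colHas lam S m j) → ¬ T (colHas lam S (suc m) j) → T (mPure lam S m j)
  colHas⇒mPure h ¬h' with anyB⁻ (boxHas m) {N} h
  ... | i , i<N , box-has-m =
    let j<λi , has-m = to (T-∧ {j <ᵇ lam ‼ i}) box-has-m
        meets-i = from (T-∧ {j <ᵇ lam ‼ i}) (j<λi , from (T-∨ {has (S i j) m}) (inj₁ has-m))
    in from (T-∧ {colNonempty lam S m j}) (anyB⁺ (meets lam S m j) {N} i<N meets-i , allB⁺ _ {N} pure)
    where
    ¬has-1+m : ∀ {i} → i < N → T (j <ᵇ lam ‼ i) → ¬ T (has (S i j) (suc m))
    ¬has-1+m {i} i<N j<λi has-1+m =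
      ¬h' (anyB⁺ (boxHas (suc m)) {N} i<N (from (T-∧ {j <ᵇ lam ‼ i}) (j<λi , has-1+m)))
    pure : ∀ {i} → i < N → T (not (meets lam S m j i) ∨ (has (S i j) m ∧ not (has (S i j) (suc m))))
    pure {i} i<N with T? (meets lam S m j i)
    ... | no ¬meets-i = from (T-∨ {not (meets lam S m j i)}) (inj₁ (T-not⁺ ¬meets-i))
    ... | yes meets-i with to (T-∧ {j <ᵇ lam ‼ i}) meets-i
    ...   | j<λi , has-m-or-1+m with to (T-∨ {has (S i j) m}) has-m-or-1+m
    ...     | inj₁ has-m = from (T-∨ {not (meets lam S m j i)})
                             (inj₂ (from (T-∧ {has (S i j) m}) (has-m , T-not⁺ (¬has-1+m i<N j<λi))))
    ...     | inj₂ has-1+m = contradiction has-1+m (¬has-1+m i<N j<λi)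

m⊓n≤o⇒m≤o : ∀ {m n o} → m ⊓ n ≤ o → o < n → m ≤ o
m⊓n≤o⇒m≤o {m} {n} m⊓n≤o o<n with ≤-total m n
... | inj₁ m≤n = subst (_≤ _) (m≤n⇒m⊓n≡m m≤n) m⊓n≤o
... | inj₂ n≤m = contradiction (subst (_≤ _) (m≥n⇒m⊓n≡n n≤m) m⊓n≤o) (<⇒≱ o<n)

m⊓n+m⊔n≡m+n : ∀ m n → (m ⊓ n) + (m ⊔ n) ≡ m + n
m⊓n+m⊔n≡m+n m n with ≤-total m n
... | inj₁ m≤n = cong₂ _+_ (m≤n⇒m⊓n≡m m≤n) (m≤n⇒m⊔n≡n m≤n)
... | inj₂ n≤m = trans (cong₂ _+_ (m≥n⇒m⊓n≡n n≤m) (m≥n⇒m⊔n≡m n≤m)) (+-comm n m)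

m+n≤o+p⇒m∸p≤o∸n : ∀ m n o p → m + n ≤ o + p → m ∸ p ≤ o ∸ n
m+n≤o+p⇒m∸p≤o∸n m n o p m+n≤o+p = begin
  m ∸ p               ≡⟨ sym ([m+n]∸[m+o]≡n∸o n m p) ⟩
  (n + m) ∸ (n + p)   ≤⟨ ∸-monoˡ-≤ (n + p) (subst (_≤ o + p) (+-comm m n) m+n≤o+p) ⟩
  (o + p) ∸ (n + p)   ≡⟨ cong₂ _∸_ (+-comm o p) (+-comm n p) ⟩
  (p + o) ∸ (p + n)   ≡⟨ [m+n]∸[m+o]≡n∸o p o n ⟩
  o ∸ n               ∎
  where open ≤-Reasoning

module _ (lam : List ℕ) where

  flatAt-suc≤ : ∀ i → flatAt lam (suc i) ≤ flatAt lam i ∸ 1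
  flatAt-suc≤ i = m⊓n≤m _ _

  flatAt-antitone : ∀ {i j} → i ≤ j → flatAt lam j ≤ flatAt lam i
  flatAt-antitone = antitone-by-steps (flatAt lam) (λ i → ≤-trans (flatAt-suc≤ i) (m∸n≤m _ 1))

  flatAt≤‼ : ∀ i → flatAt lam i ≤ lam ‼ i
  flatAt≤‼ zero = ≤-refl
  flatAt≤‼ (suc i) = m⊓n≤n _ _

  flatAt≤head : ∀ i → flatAt lam i ≤ lam ‼ 0
  flatAt≤head i = flatAt-antitone {0} {i} z≤n

  flatAt-strict : ∀ {i j} → i < j → 0 < flatAt lam j → flatAt lam j < flatAt lam i
  flatAt-strict {i} {j} i<j pos = ≤∸1⇒< (≤-trans (flatAt-antitone {suc i} i<j) (flatAt-suc≤ i))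
    where
    ≤∸1⇒< : ∀ {b} → flatAt lam j ≤ b ∸ 1 → flatAt lam j < b
    ≤∸1⇒< {zero} fj≤0 = contradiction pos (≤⇒≯ fj≤0)
    ≤∸1⇒< {suc b} fj≤b = s≤s fj≤b

  flatAt-injective : ∀ {i j} → 0 < flatAt lam i → flatAt lam i ≡ flatAt lam j → i ≡ j
  flatAt-injective {i} {j} pos eq with <-cmp i j
  ... | tri< i<j _ _ = contradiction (sym eq) (<⇒≢ (flatAt-strict i<j (subst (0 <_) eq pos)))
  ... | tri≈ _ i≡j _ = i≡j
  ... | tri> _ _ j<i = contradiction eq (<⇒≢ (flatAt-strict j<i pos))

  flatAt-positive : ∀ {r} → r < flatLen lam → 0 < flatAt lam r
  flatAt-positive r<k = <ᵇ⇒< 0 _ (countB-downClosed⁻ (λ i → 0 <ᵇ flatAt lam i) closed {length lam} r<k)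
    where
    closed : DownClosed (λ i → 0 <ᵇ flatAt lam i)
    closed i pos = <⇒<ᵇ (<-≤-trans (<ᵇ⇒< 0 _ pos) (flatAt-antitone {i} (n≤1+n i)))

flatAt-gap : ∀ {lam} → IsPartition lam → ∀ {i c} → c < lam ‼ i → flatAt lam i ≤ c →
             ∃[ r ] r < i × flatAt lam r ≡ suc c
flatAt-gap _ {zero} c<λ0 f0≤c = contradiction c<λ0 (≤⇒≯ f0≤c)
flatAt-gap {lam} isPartition {suc i} {c} c<λ f≤c =
  [ (λ fi<1+c → let r , r<i , fr≡1+c = flatAt-gap isPartition c<λi (s≤s⁻¹ fi<1+c)
                in r , m<n⇒m<1+n r<i , fr≡1+c)
  , (λ fi≡1+c → i , n<1+n i , fi≡1+c)
  ]′ (m≤n⇒m<n∨m≡n fi≤1+c)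
  where
  fi≤1+c : flatAt lam i ≤ suc c
  fi≤1+c = ≤-trans (m≤n+m∸n (flatAt lam i) 1) (s≤s (m⊓n≤o⇒m≤o f≤c c<λ))
  c<λi : c < lam ‼ i
  c<λi = <-≤-trans c<λ (partition-antitone isPartition (n≤1+n i))

module _ (n : ℕ) (lam : List ℕ) where

  barAt-< : ∀ {i} → i < flatLen lam → barAt n lam i ≡ flatAt lam i + i
  barAt-< {i} i<k = cong (λ b → if b then flatAt lam i + i else flatLen lam) (to T-≡ (<⇒<ᵇ i<k))

  barAt-≥ : ∀ {i} → flatLen lam ≤ i → barAt n lam i ≡ flatLen lam
  barAt-≥ {i} k≤i = cong (λ b → if b then flatAt lam i + i else flatLen lam)
                          (¬T⇒≡false (≤⇒≯ k≤i ∘ <ᵇ⇒< i (flatLen lam)))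

module _ (n : ℕ) (lam rho : List ℕ) (⊆bar : rho ⊆P bar n lam) where

  private
    k = flatLen lam

  ⊆bar⇒vanishes : ∀ {i} → n ≤ i → rho ‼ i ≡ 0
  ⊆bar⇒vanishes {i} n≤i = n≤0⇒n≡0 (subst (rho ‼ i ≤_) (‼-map-applyUpTo-≥ (barAt n lam) id n≤i) (⊆bar i))

  ⊆bar⇒≤barAt : ∀ {i} → i < n → rho ‼ i ≤ barAt n lam i
  ⊆bar⇒≤barAt {i} i<n = subst (rho ‼ i ≤_) (‼-map-applyUpTo (barAt n lam) id i<n) (⊆bar i)

  ⊆bar⇒≤flatLen : ∀ {i} → k ≤ i → rho ‼ i ≤ k
  ⊆bar⇒≤flatLen {i} k≤i with i <? n
  ... | yes i<n = subst (rho ‼ i ≤_) (barAt-≥ n lam k≤i) (⊆bar⇒≤barAt i<n)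
  ... | no i≮n = subst (_≤ k) (sym (⊆bar⇒vanishes (≮⇒≥ i≮n))) z≤n

  ⊆bar⇒≤flatAt+ : ∀ i → rho ‼ i ≤ flatAt lam i + i
  ⊆bar⇒≤flatAt+ i with i <? k | i <? n
  ... | _ | no i≮n = subst (_≤ _) (sym (⊆bar⇒vanishes (≮⇒≥ i≮n))) z≤n
  ... | yes i<k | yes i<n = subst (rho ‼ i ≤_) (barAt-< n lam i<k) (⊆bar⇒≤barAt i<n)
  ... | no i≮k | yes _ = ≤-trans (⊆bar⇒≤flatLen (≮⇒≥ i≮k)) (≤-trans (≮⇒≥ i≮k) (m≤n+m i _))

  ⊆bar⇒flatAt-positive : ∀ {r ℓ} → r < ℓ → r < rho ‼ ℓ → 0 < flatAt lam r
  ⊆bar⇒flatAt-positive {r} {ℓ} r<ℓ r<ρℓ with ℓ <? k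
  ... | yes ℓ<k = flatAt-positive lam (<-trans r<ℓ ℓ<k)
  ... | no ℓ≮k = flatAt-positive lam (<-≤-trans r<ρℓ (⊆bar⇒≤flatLen (≮⇒≥ ℓ≮k)))

conjugate : List ℕ → ℕ → ℕ → ℕ
conjugate rho n r = countB (λ ℓ → r <ᵇ rho ‼ ℓ) n

module _ {rho n} (isPartition : IsPartition rho) (vanishes : ∀ {i} → n ≤ i → rho ‼ i ≡ 0) where

  private
    closed : ∀ r → DownClosed (λ ℓ → r <ᵇ rho ‼ ℓ)
    closed r ℓ r<ρ = <⇒<ᵇ (<-≤-trans (<ᵇ⇒< r _ r<ρ) (partition-antitone isPartition (n≤1+n ℓ)))

  <conjugate⇔ : ∀ {r ℓ} → ℓ < conjugate rho n r ⇔ r < rho ‼ ℓ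
  <conjugate⇔ {r} {ℓ} = mk⇔
    (<ᵇ⇒< r _ ∘ countB-downClosed⁻ _ (closed r) {n})
    (λ r<ρℓ → countB-downClosed⁺ _ (closed r) (ℓ<n r<ρℓ) (<⇒<ᵇ r<ρℓ))
    where
    ℓ<n : r < rho ‼ ℓ → ℓ < n
    ℓ<n r<ρℓ with ℓ <? n
    ... | yes ℓ<n = ℓ<n
    ... | no ℓ≮n = contradiction (subst (r <_) (vanishes (≮⇒≥ ℓ≮n)) r<ρℓ) λ ()

conjugate-antitone : ∀ rho n {r r'} → r' ≤ r → conjugate rho n r ≤ conjugate rho n r'
conjugate-antitone rho n r'≤r =
  countB-mono _ _ n (λ {i} _ r<ρ → <⇒<ᵇ (≤-<-trans r'≤r (<ᵇ⇒< _ (rho ‼ i) r<ρ)))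

module Construction (n : ℕ) {lam rho : List ℕ}
  (isPartition-lam : IsPartition lam) (isPartition-rho : IsPartition rho)
  (λ₀≤ρ₀ : lam ‼ 0 ≤ rho ‼ 0) (⊆bar : rho ⊆P bar n lam) where

  f : ℕ → ℕ
  f = flatAt lam

  λ₀ : ℕ
  λ₀ = lam ‼ 0

  ρ : ℕ → ℕ
  ρ i = rho ‼ i

  conj : ℕ → ℕ
  conj = conjugate rho n

  own : ℕ → ℕ
  own i = ρ i ∸ i

  segStart : ℕ → ℕ
  segStart i = f i ∸ own i

  -- Row i of λ♭ carries the letter i in the columns [segStart i, f i), and every other box
  -- of λ♭ repeats the letter of the nearest such segment above it (row 0 covers all of λ♭).
  opaque
    inSegment : ℕ → ℕ → Bool
    inSegment i j = (segStart i ≤ᵇ j) ∧ (j <ᵇ f i)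

    inSegment⁺ : ∀ {i j} → segStart i ≤ j → j < f i → T (inSegment i j)
    inSegment⁺ s≤j j<f = from T-∧ (≤⇒≤ᵇ s≤j , <⇒<ᵇ j<f)

    inSegment⇒segStart≤ : ∀ {i j} → T (inSegment i j) → segStart i ≤ j
    inSegment⇒segStart≤ {i} = ≤ᵇ⇒≤ (segStart i) _ ∘ proj₁ ∘ to T-∧

    inSegment⇒<f : ∀ {i j} → T (inSegment i j) → j < f i
    inSegment⇒<f {i} {j} = <ᵇ⇒< j (f i) ∘ proj₂ ∘ to (T-∧ {segStart i ≤ᵇ j})

  cover : ℕ → ℕ → ℕ
  cover zero j = 0
  cover (suc i) j = if inSegment (suc i) j then suc i else cover i j

  opaque
    endsAt : ℕ → ℕ → Bool
    endsAt r j = f r ≡ᵇ suc j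

    endAtOrAbove : ℕ → ℕ → Bool
    endAtOrAbove i j = anyB (λ r → endsAt r j) (suc i)

    endsAt⁺ : ∀ {r j} → f r ≡ suc j → T (endsAt r j)
    endsAt⁺ {r} = ≡⇒≡ᵇ (f r) _

    endsAt⁻ : ∀ {r j} → T (endsAt r j) → f r ≡ suc j
    endsAt⁻ {r} = ≡ᵇ⇒≡ (f r) _

    endAtOrAbove⁺ : ∀ {r i j} → r ≤ i → f r ≡ suc j → T (endAtOrAbove i j)
    endAtOrAbove⁺ {r} r≤i fr≡1+j = anyB⁺ _ (s≤s r≤i) (endsAt⁺ {r} fr≡1+j)

    endAtOrAbove⁻ : ∀ {i j} → T (endAtOrAbove i j) → ∃[ r ] r ≤ i × f r ≡ suc j
    endAtOrAbove⁻ {i} e =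
      let r , r<1+i , er = anyB⁻ _ {suc i} e in r , s≤s⁻¹ r<1+i , endsAt⁻ {r} er

  spread : ℕ → ℕ
  spread r = conj r ∸ suc r

  top : ℕ → ℕ → ℕ
  top r j = cover r j + spread r

  hi : ℕ → ℕ → ℕ
  hi zero j = if endsAt 0 j then top 0 j else cover 0 j
  hi (suc i) j =
    if endAtOrAbove i j then hi i j
    else (if endsAt (suc i) j then top (suc i) j else cover (suc i) j)

  lo : ℕ → ℕ → ℕ
  lo zero j = cover 0 j
  lo (suc i) j = if endAtOrAbove i j then hi i j else cover (suc i) j

  ρ-vanishes : ∀ {i} → n ≤ i → ρ i ≡ 0
  ρ-vanishes = ⊆bar⇒vanishes n lam rho ⊆bar

  ρ-antitone : ∀ {i j} → i ≤ j → ρ j ≤ ρ i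
  ρ-antitone = partition-antitone isPartition-rho

  i<ρi⇒i<n : ∀ {i} → i < ρ i → i < n
  i<ρi⇒i<n {i} i<ρi with i <? n
  ... | yes i<n = i<n
  ... | no i≮n = contradiction (subst (i <_) (ρ-vanishes (≮⇒≥ i≮n)) i<ρi) λ ()

  <conj⇔ : ∀ {r ℓ} → ℓ < conj r ⇔ r < ρ ℓ
  <conj⇔ = <conjugate⇔ isPartition-rho ρ-vanishes

  conj≤n : ∀ r → conj r ≤ n
  conj≤n r = countB≤ _ n

  ρ₀≡λ₀ : ρ 0 ≡ λ₀
  ρ₀≡λ₀ = ≤-antisym (subst (ρ 0 ≤_) (+-identityʳ λ₀) (⊆bar⇒≤flatAt+ n lam rho ⊆bar 0)) λ₀≤ρ₀

  own≤f : ∀ i → own i ≤ f i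
  own≤f i = subst (own i ≤_) (m+n∸n≡m (f i) i) (∸-monoˡ-≤ i (⊆bar⇒≤flatAt+ n lam rho ⊆bar i))

  <λ₀ : ∀ {i j} → j < lam ‼ i → j < λ₀
  <λ₀ j<λi = <-≤-trans j<λi (partition-antitone isPartition-lam z≤n)

  end⇒<λ₀ : ∀ {r j} → f r ≡ suc j → j < λ₀
  end⇒<λ₀ {r} {j} fr≡1+j = <-≤-trans (subst (j <_) (sym fr≡1+j) (n<1+n j)) (flatAt≤head lam r)

  f-step : ∀ {r c} → r < c → f c ≤ f r ∸ 1
  f-step {r} r<c = ≤-trans (flatAt-antitone lam {suc r} r<c) (flatAt-suc≤ lam r)

  end-unique : ∀ {r r' j} → f r ≡ suc j → f r' ≡ suc j → r ≡ r'
  end-unique fr≡1+j fr'≡1+j =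
    flatAt-injective lam (subst (0 <_) (sym fr≡1+j) z<s) (trans fr≡1+j (sym fr'≡1+j))

  inSegment⇒i<ρi : ∀ {i j} → T (inSegment i j) → i < ρ i
  inSegment⇒i<ρi {i} {j} seg = m∸n≢0⇒n<m own≢0
    where
    own≢0 : own i ≢ 0
    own≢0 own≡0 =
      <⇒≱ (inSegment⇒<f seg) (subst (_≤ j) (cong (f i ∸_) own≡0) (inSegment⇒segStart≤ seg))

  inSegment-last : ∀ {i j} → i < ρ i → f i ≡ suc j → T (inSegment i j)
  inSegment-last {i} {j} i<ρi fi≡1+j = inSegment⁺
    (subst (λ x → x ∸ own i ≤ j) (sym fi≡1+j) (∸-monoʳ-≤ (suc j) (m<n⇒0<n∸m i<ρi)))
    (subst (j <_) (sym fi≡1+j) (n<1+n j))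

  inSegment-head : ∀ {j} → j < λ₀ → T (inSegment 0 j)
  inSegment-head {j} j<λ₀ = inSegment⁺ (subst (_≤ j) (sym segStart₀≡0) z≤n) j<λ₀
    where
    segStart₀≡0 : segStart 0 ≡ 0
    segStart₀≡0 = trans (cong (λ₀ ∸_) ρ₀≡λ₀) (n∸n≡0 λ₀)

  inSegment-suc : ∀ {i j} → T (inSegment i j) → suc j < f i → T (inSegment i (suc j))
  inSegment-suc seg 1+j<f = inSegment⁺ (m≤n⇒m≤1+n (inSegment⇒segStart≤ seg)) 1+j<f

  cover≤ : ∀ i j → cover i j ≤ i
  cover≤ zero j = z≤n
  cover≤ (suc i) j with T? (inSegment (suc i) j)
  ... | yes seg = ≤-reflexive (if-true seg)
  ... | no ¬seg = ≤-trans (≤-reflexive (if-false ¬seg)) (m≤n⇒m≤1+n (cover≤ i j))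

  cover-suc : ∀ i j → cover i j ≤ cover (suc i) j
  cover-suc i j with T? (inSegment (suc i) j)
  ... | yes seg = ≤-trans (m≤n⇒m≤1+n (cover≤ i j)) (≤-reflexive (sym (if-true seg)))
  ... | no ¬seg = ≤-reflexive (sym (if-false ¬seg))

  cover-maximal : ∀ {i' i j} → i' ≤ i → T (inSegment i' j) → i' ≤ cover i j
  cover-maximal {zero} _ _ = z≤n
  cover-maximal {suc i'} {suc i} {j} i'≤i seg with m≤n⇒m<n∨m≡n i'≤i
  ... | inj₁ i'<i = ≤-trans (cover-maximal (s≤s⁻¹ i'<i) seg) (cover-suc i j)
  ... | inj₂ refl = ≤-reflexive (sym (if-true seg))

  cover-inSegment : ∀ i {j} → j < λ₀ → T (inSegment (cover i j) j)
  cover-inSegment zero j<λ₀ = inSegment-head j<λ₀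
  cover-inSegment (suc i) {j} j<λ₀ with T? (inSegment (suc i) j)
  ... | yes seg = subst (λ c → T (inSegment c j)) (sym (if-true seg)) seg
  ... | no ¬seg = subst (λ c → T (inSegment c j)) (sym (if-false ¬seg)) (cover-inSegment i j<λ₀)

  cover-self : ∀ {i j} → T (inSegment i j) → cover i j ≡ i
  cover-self {i} {j} seg = ≤-antisym (cover≤ i j) (cover-maximal ≤-refl seg)

  data Box (i j : ℕ) : Set where
    aboveEnd : ¬ T (endAtOrAbove i j) → lo i j ≡ cover i j → hi i j ≡ cover i j → Box i j
    atEnd    : f i ≡ suc j → lo i j ≡ cover i j → hi i j ≡ top i j → Box i j
    belowEnd : ∀ {r} → r < i → f r ≡ suc j → lo i j ≡ top r j → hi i j ≡ top r j → Box i j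

  box : ∀ i j → Box i j
  box zero j with T? (endsAt 0 j)
  ... | yes e = atEnd (endsAt⁻ e) refl (if-true e)
  ... | no ¬e = aboveEnd ¬e₀ refl (if-false ¬e)
    where
    ¬e₀ : ¬ T (endAtOrAbove 0 j)
    ¬e₀ e₀ = let _ , r≤0 , fr≡1+j = endAtOrAbove⁻ e₀
             in ¬e (endsAt⁺ (subst (λ r → f r ≡ suc j) (n≤0⇒n≡0 r≤0) fr≡1+j))
  box (suc i) j with box i j
  ... | atEnd fi≡1+j _ hi≡ = let e = endAtOrAbove⁺ ≤-refl fi≡1+j in
    belowEnd (n<1+n i) fi≡1+j (trans (if-true e) hi≡) (trans (if-true e) hi≡)
  ... | belowEnd r<i fr≡1+j _ hi≡ = let e = endAtOrAbove⁺ (<⇒≤ r<i) fr≡1+j in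
    belowEnd (m<n⇒m<1+n r<i) fr≡1+j (trans (if-true e) hi≡) (trans (if-true e) hi≡)
  ... | aboveEnd ¬e _ _ with T? (endsAt (suc i) j)
  ...   | yes e' = atEnd (endsAt⁻ e') (if-false ¬e) (trans (if-false ¬e) (if-true e'))
  ...   | no ¬e' = aboveEnd ¬e'' (if-false ¬e) (trans (if-false ¬e) (if-false ¬e'))
    where
    ¬e'' : ¬ T (endAtOrAbove (suc i) j)
    ¬e'' e'' with endAtOrAbove⁻ e''
    ... | r , r≤1+i , fr≡1+j with m≤n⇒m<n∨m≡n r≤1+i
    ...   | inj₁ r<1+i = ¬e (endAtOrAbove⁺ (s≤s⁻¹ r<1+i) fr≡1+j)
    ...   | inj₂ refl = ¬e' (endsAt⁺ fr≡1+j)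

  box-aboveEnd : ∀ {i j} → ¬ T (endAtOrAbove i j) → hi i j ≡ cover i j
  box-aboveEnd {i} {j} ¬e with box i j
  ... | aboveEnd _ _ hi≡ = hi≡
  ... | atEnd fi≡1+j _ _ = contradiction (endAtOrAbove⁺ ≤-refl fi≡1+j) ¬e
  ... | belowEnd r<i fr≡1+j _ _ = contradiction (endAtOrAbove⁺ (<⇒≤ r<i) fr≡1+j) ¬e

  box-atEnd : ∀ {r j} → f r ≡ suc j → lo r j ≡ cover r j × hi r j ≡ top r j
  box-atEnd {r} {j} fr≡1+j with box r j
  ... | aboveEnd ¬e _ _ = contradiction (endAtOrAbove⁺ ≤-refl fr≡1+j) ¬e
  ... | atEnd _ lo≡ hi≡ = lo≡ , hi≡
  ... | belowEnd {r'} r'<r fr'≡1+j _ _ =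
    contradiction (end-unique {r'} {r} fr'≡1+j fr≡1+j) (<⇒≢ r'<r)

  box-belowEnd : ∀ {r i j} → r < i → f r ≡ suc j → lo i j ≡ top r j
  box-belowEnd {r} {i} {j} r<i fr≡1+j with box i j
  ... | aboveEnd ¬e _ _ = contradiction (endAtOrAbove⁺ (<⇒≤ r<i) fr≡1+j) ¬e
  ... | atEnd fi≡1+j _ _ = contradiction (end-unique {r} {i} fr≡1+j fi≡1+j) (<⇒≢ r<i)
  ... | belowEnd {r'} _ fr'≡1+j lo≡ _ with end-unique {r'} {r} fr'≡1+j fr≡1+j
  ...   | refl = lo≡

  cover<n : ∀ i {j} → j < λ₀ → cover i j < n
  cover<n i j<λ₀ = i<ρi⇒i<n (inSegment⇒i<ρi (cover-inSegment i j<λ₀))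

  top< : ∀ {r j c} → cover r j < c → conj r ≤ c → top r j < c
  top< {r} {j} {c} cover<c conj≤c with suc r ≤? conj r
  ... | yes 1+r≤conj = begin-strict
    cover r j + (conj r ∸ suc r)   ≤⟨ +-monoˡ-≤ (conj r ∸ suc r) (cover≤ r j) ⟩
    r + (conj r ∸ suc r)           <⟨ n<1+n _ ⟩
    suc r + (conj r ∸ suc r)       ≡⟨ m+[n∸m]≡n 1+r≤conj ⟩
    conj r                         ≤⟨ conj≤c ⟩
    c                              ∎
    where open ≤-Reasoning
  ... | no 1+r≰conj = subst (_< c) (sym top≡cover) cover<c
    where
    top≡cover : top r j ≡ cover r j
    top≡cover = trans (cong (cover r j +_) (m≤n⇒m∸n≡0 (<⇒≤ (≰⇒> 1+r≰conj)))) (+-identityʳ _)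

  lo≤hi : ∀ i j → lo i j ≤ hi i j
  lo≤hi i j with box i j
  ... | aboveEnd _ lo≡ hi≡ = ≤-reflexive (trans lo≡ (sym hi≡))
  ... | atEnd _ lo≡ hi≡ = subst₂ _≤_ (sym lo≡) (sym hi≡) (m≤m+n _ _)
  ... | belowEnd _ _ lo≡ hi≡ = ≤-reflexive (trans lo≡ (sym hi≡))

  hi<n : ∀ i {j} → j < λ₀ → hi i j < n
  hi<n i {j} j<λ₀ with box i j
  ... | aboveEnd _ _ hi≡ = subst (_< n) (sym hi≡) (cover<n i j<λ₀)
  ... | atEnd _ _ hi≡ = subst (_< n) (sym hi≡) (top< (cover<n i j<λ₀) (conj≤n i))
  ... | belowEnd {r} _ _ _ hi≡ = subst (_< n) (sym hi≡) (top< (cover<n r j<λ₀) (conj≤n r))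

  hi≤lo-below : ∀ i j → hi i j ≤ lo (suc i) j
  hi≤lo-below i j with T? (endAtOrAbove i j)
  ... | yes e = ≤-reflexive (sym (if-true e))
  ... | no ¬e = subst₂ _≤_ (sym (box-aboveEnd ¬e)) (sym (if-false ¬e)) (cover-suc i j)

  cover≤lo-right : ∀ {i j} → ¬ T (endAtOrAbove i j) → j < λ₀ → cover i j ≤ lo i (suc j)
  cover≤lo-right {i} {j} ¬e j<λ₀ = from-box (box i (suc j))
    where
    c = cover i j
    seg = cover-inSegment i j<λ₀
    1+j<fc : suc j < f c
    1+j<fc = ≤∧≢⇒< (inSegment⇒<f seg) (λ 1+j≡fc → ¬e (endAtOrAbove⁺ (cover≤ i j) (sym 1+j≡fc)))
    seg' = inSegment-suc seg 1+j<fc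
    from-box : Box i (suc j) → c ≤ lo i (suc j)
    from-box (aboveEnd _ lo≡ _) = subst (c ≤_) (sym lo≡) (cover-maximal (cover≤ i j) seg')
    from-box (atEnd _ lo≡ _) = subst (c ≤_) (sym lo≡) (cover-maximal (cover≤ i j) seg')
    from-box (belowEnd {r} _ fr≡2+j lo≡ _) with c ≤? r
    ... | yes c≤r = subst (c ≤_) (sym lo≡) (≤-trans (cover-maximal c≤r seg') (m≤m+n _ _))
    ... | no c≰r =
      contradiction (subst (f c ≤_) (cong (_∸ 1) fr≡2+j) (f-step (≰⇒> c≰r))) (<⇒≱ 1+j<fc)

  top≤top-right : ∀ {r r' j} → r' < r → f r ≡ suc j → f r' ≡ suc (suc j) →
                  top r j ≤ top r' (suc j)
  top≤top-right {r} {r'} {j} r'<r fr≡1+j fr'≡2+j = by-cases (c ≤? r')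
    where
    c = cover r j
    seg = cover-inSegment r (end⇒<λ₀ {r} fr≡1+j)
    conj≤conj' : conj r ≤ conj r'
    conj≤conj' = conjugate-antitone rho n (<⇒≤ r'<r)
    by-cases : Dec (c ≤ r') → top r j ≤ top r' (suc j)
    by-cases (yes c≤r') = +-mono-≤ (cover-maximal c≤r' seg') (∸-mono conj≤conj' (s≤s (<⇒≤ r'<r)))
      where
      1+j<fc : suc j < f c
      1+j<fc = <-≤-trans (subst (suc j <_) (sym fr'≡2+j) (n<1+n (suc j))) (flatAt-antitone lam c≤r')
      seg' = inSegment-suc seg 1+j<fc
    -- Here row r' has its own segment, ending in column j + 1, and top r' (j + 1) = conj r' - 1.
    by-cases (no c≰r') = s≤s⁻¹ (begin-strict
      top r j                <⟨ top< c<conj' conj≤conj' ⟩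
      conj r'                ≡⟨ sym (m+[n∸m]≡n 1+r'≤conj') ⟩
      suc r' + spread r'     ≡⟨ cong (λ x → suc (x + spread r')) (sym cover'≡r') ⟩
      suc (top r' (suc j))   ∎)
      where
      open ≤-Reasoning
      r'<c = ≰⇒> c≰r'
      r'<ρc : r' < ρ c
      r'<ρc = <-trans r'<c (inSegment⇒i<ρi seg)
      c<conj' : c < conj r'
      c<conj' = from <conj⇔ r'<ρc
      1+r'≤conj' : suc r' ≤ conj r'
      1+r'≤conj' = <-trans r'<c c<conj'
      cover'≡r' : cover r' (suc j) ≡ r'
      cover'≡r' = cover-self (inSegment-last (<-≤-trans r'<ρc (ρ-antitone (<⇒≤ r'<c))) fr'≡2+j)

  top≤lo-right : ∀ {r i j} → r ≤ i → f r ≡ suc j → suc j < lam ‼ i → top r j ≤ lo i (suc j)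
  top≤lo-right {r} {i} {j} r≤i fr≡1+j 1+j<λi =
    subst (top r j ≤_) (sym (box-belowEnd r'<i fr'≡2+j)) (top≤top-right r'<r fr≡1+j fr'≡2+j)
    where
    gap = flatAt-gap isPartition-lam 1+j<λi (subst (f i ≤_) fr≡1+j (flatAt-antitone lam r≤i))
    r' = proj₁ gap
    r'<i = proj₁ (proj₂ gap)
    fr'≡2+j = proj₂ (proj₂ gap)
    r'<r : r' < r
    r'<r = ≰⇒> (λ r≤r' → <-irrefl refl (subst₂ _≤_ fr'≡2+j fr≡1+j (flatAt-antitone lam r≤r')))

  hi≤lo-right : ∀ {i j} → suc j < lam ‼ i → hi i j ≤ lo i (suc j)
  hi≤lo-right {i} {j} 1+j<λi with box i j
  ... | aboveEnd ¬e _ hi≡ =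
    subst (_≤ lo i (suc j)) (sym hi≡) (cover≤lo-right ¬e (<λ₀ {i} (<-trans (n<1+n j) 1+j<λi)))
  ... | atEnd fi≡1+j _ hi≡ =
    subst (_≤ lo i (suc j)) (sym hi≡) (top≤lo-right ≤-refl fi≡1+j 1+j<λi)
  ... | belowEnd r<i fr≡1+j _ hi≡ =
    subst (_≤ lo i (suc j)) (sym hi≡) (top≤lo-right (<⇒≤ r<i) fr≡1+j 1+j<λi)

  opaque
    filling : Filling n
    filling i j = tabulate ((λ x → (lo i j ≤ᵇ x) ∧ (x ≤ᵇ hi i j)) ∘ toℕ)

    ∈filling⇔ : ∀ {i j ℓ} → T (has (filling i j) ℓ) ⇔ (ℓ < n × lo i j ≤ ℓ × ℓ ≤ hi i j)
    ∈filling⇔ {i} {j} {ℓ} = mk⇔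
      (λ h → let ℓ<n , lo≤ℓ≤hi = to T-∧ (subst T has≡ h)
                 lo≤ℓ , ℓ≤hi = to (T-∧ {lo i j ≤ᵇ ℓ}) lo≤ℓ≤hi
             in <ᵇ⇒< ℓ n ℓ<n , ≤ᵇ⇒≤ (lo i j) ℓ lo≤ℓ , ≤ᵇ⇒≤ ℓ (hi i j) ℓ≤hi)
      (λ (ℓ<n , lo≤ℓ , ℓ≤hi) →
        subst T (sym has≡) (from T-∧ (<⇒<ᵇ ℓ<n , from T-∧ (≤⇒≤ᵇ lo≤ℓ , ≤⇒≤ᵇ ℓ≤hi))))
      where
      has≡ : has (filling i j) ℓ ≡ (ℓ <ᵇ n) ∧ ((lo i j ≤ᵇ ℓ) ∧ (ℓ ≤ᵇ hi i j))
      has≡ = has-tabulate n (λ x → (lo i j ≤ᵇ x) ∧ (x ≤ᵇ hi i j)) ℓ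

  filling-≤S : ∀ {i j i' j'} → hi i j ≤ lo i' j' → filling i j ≤S filling i' j'
  filling-≤S hi≤lo a b a∈ b∈ = ≤-trans a≤hi (≤-trans hi≤lo lo≤b)
    where
    a≤hi = proj₂ (proj₂ (to ∈filling⇔ (from T-≡ a∈)))
    lo≤b = proj₁ (proj₂ (to ∈filling⇔ (from T-≡ b∈)))

  filling-isSVRPP : IsSVRPP n lam filling
  filling-isSVRPP =
    nonempty , (λ i j 1+j<λi → filling-≤S (hi≤lo-right 1+j<λi)) , (λ i j _ → filling-≤S (hi≤lo-below i j))
    where
    nonempty : ∀ i j → InDiagram lam i j → SetNonempty (filling i j)
    nonempty i j j<λi = lo i j , to T-≡ (from ∈filling⇔ (lo<n , ≤-refl , lo≤hi i j))
      where
      lo<n = ≤-<-trans (lo≤hi i j) (hi<n i (<λ₀ {i} j<λi))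

  colHas⁺ : ∀ {i j ℓ} → j < lam ‼ i → lo i j ≤ ℓ → ℓ ≤ hi i j → T (colHas lam filling ℓ j)
  colHas⁺ {i} {j} {ℓ} j<λi lo≤ℓ ℓ≤hi = anyB⁺ (λ i → (j <ᵇ lam ‼ i) ∧ has (filling i j) ℓ)
    (‼-positive⇒<length lam (≤-<-trans z≤n j<λi))
    (from T-∧ (<⇒<ᵇ j<λi , from ∈filling⇔ (≤-<-trans ℓ≤hi (hi<n i (<λ₀ {i} j<λi)) , lo≤ℓ , ℓ≤hi)))

  colHas⁻ : ∀ {j ℓ} → T (colHas lam filling ℓ j) → ∃[ i ] lo i j ≤ ℓ × ℓ ≤ hi i j
  colHas⁻ {j} {ℓ} h =
    let i , _ , box-has = anyB⁻ (λ i → (j <ᵇ lam ‼ i) ∧ has (filling i j) ℓ) {length lam} h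
    in i , proj₂ (to ∈filling⇔ (proj₂ (to (T-∧ {j <ᵇ lam ‼ i}) box-has)))

  -- Besides its segment, letter ℓ lies in the last column of each row r < ℓ ⊓ ρ ℓ of λ♭.
  opaque
    extra : ℕ → ℕ → Bool
    extra ℓ j = anyB (λ r → f r ≡ᵇ suc j) (ℓ ⊓ ρ ℓ)

    extra⁺ : ∀ {ℓ j r} → r < ℓ → r < ρ ℓ → f r ≡ suc j → T (extra ℓ j)
    extra⁺ {r = r} r<ℓ r<ρℓ fr≡1+j = anyB⁺ _ (⊓-glb r<ℓ r<ρℓ) (≡⇒≡ᵇ (f r) _ fr≡1+j)

    extra⁻ : ∀ {ℓ j} → T (extra ℓ j) → ∃[ r ] r < ℓ × r < ρ ℓ × f r ≡ suc j
    extra⁻ {ℓ} e =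
      let r , r<ℓ⊓ρℓ , fr≡ᵇ1+j = anyB⁻ _ e
      in r , m≤n⊓o⇒m≤n ℓ (ρ ℓ) r<ℓ⊓ρℓ , m≤n⊓o⇒m≤o ℓ (ρ ℓ) r<ℓ⊓ρℓ , ≡ᵇ⇒≡ (f r) _ fr≡ᵇ1+j

    countB-extra : ∀ ℓ → countB (extra ℓ) λ₀ ≡ ℓ ⊓ ρ ℓ
    countB-extra ℓ = countB-image f (ℓ ⊓ ρ ℓ) λ₀
      (λ {r} r<ℓ⊓ρℓ → positive r<ℓ⊓ρℓ , flatAt≤head lam r)
      (λ r<ℓ⊓ρℓ _ → flatAt-injective lam (positive r<ℓ⊓ρℓ))
      where
      positive : ∀ {r} → r < ℓ ⊓ ρ ℓ → 0 < f r
      positive r<ℓ⊓ρℓ =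
        ⊆bar⇒flatAt-positive n lam rho ⊆bar (m≤n⊓o⇒m≤n ℓ (ρ ℓ) r<ℓ⊓ρℓ) (m≤n⊓o⇒m≤o ℓ (ρ ℓ) r<ℓ⊓ρℓ)

  opaque
    unfolding inSegment

    countB-inSegment : ∀ ℓ → countB (inSegment ℓ) λ₀ ≡ own ℓ
    countB-inSegment ℓ = begin
      countB (inSegment ℓ) λ₀    ≡⟨ countB-interval≤ (segStart ℓ) (flatAt≤head lam ℓ) ⟩
      f ℓ ∸ (f ℓ ∸ own ℓ)        ≡⟨ m∸[m∸n]≡n (own≤f ℓ) ⟩
      own ℓ                      ∎
      where open ≡-Reasoning

  lo-inSegment : ∀ {ℓ j} → T (inSegment ℓ j) → lo ℓ j ≡ ℓ
  lo-inSegment {ℓ} {j} seg with box ℓ j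
  ... | aboveEnd _ lo≡ _ = trans lo≡ (cover-self seg)
  ... | atEnd _ lo≡ _ = trans lo≡ (cover-self seg)
  ... | belowEnd r<ℓ fr≡1+j _ _ = contradiction
    (subst (f ℓ <_) fr≡1+j (flatAt-strict lam r<ℓ (≤-<-trans z≤n (inSegment⇒<f seg))))
    (<⇒≱ (s≤s (inSegment⇒<f seg)))

  inSegment⇒colHas : ∀ {ℓ j} → T (inSegment ℓ j) → T (colHas lam filling ℓ j)
  inSegment⇒colHas {ℓ} {j} seg = colHas⁺ (<-≤-trans (inSegment⇒<f seg) (flatAt≤‼ lam ℓ))
    (≤-reflexive (lo-inSegment seg)) (subst (_≤ hi ℓ j) (lo-inSegment seg) (lo≤hi ℓ j))

  extra⇒colHas : ∀ {ℓ j} → T (extra ℓ j) → T (colHas lam filling ℓ j)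
  extra⇒colHas {ℓ} {j} e with extra⁻ e
  ... | r , r<ℓ , r<ρℓ , fr≡1+j =
    colHas⁺ (<-≤-trans (subst (j <_) (sym fr≡1+j) (n<1+n j)) (flatAt≤‼ lam r))
            (subst (_≤ ℓ) (sym lo≡r) (<⇒≤ r<ℓ)) (subst (ℓ ≤_) (sym (proj₂ (box-atEnd {r} fr≡1+j))) ℓ≤top)
    where
    cover≡r : cover r j ≡ r
    cover≡r = cover-self (inSegment-last (<-≤-trans r<ρℓ (ρ-antitone (<⇒≤ r<ℓ))) fr≡1+j)
    lo≡r = trans (proj₁ (box-atEnd {r} fr≡1+j)) cover≡r
    ℓ<conj : ℓ < conj r
    ℓ<conj = from <conj⇔ r<ρℓ
    ℓ≤top : ℓ ≤ top r j
    ℓ≤top = subst (ℓ ≤_) (cong (_+ spread r) (sym cover≡r))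
      (s≤s⁻¹ (subst (ℓ <_) (sym (m+[n∸m]≡n (<-trans r<ℓ ℓ<conj))) ℓ<conj))

  endBox⇒inSegment⊎extra : ∀ {r j ℓ} → f r ≡ suc j → cover r j ≤ ℓ → ℓ ≤ top r j →
                           T (inSegment ℓ j) ⊎ T (extra ℓ j)
  endBox⇒inSegment⊎extra {r} {j} {ℓ} fr≡1+j cover≤ℓ ℓ≤top with m≤n⇒m<n∨m≡n cover≤ℓ
  ... | inj₂ cover≡ℓ =
    inj₁ (subst (λ c → T (inSegment c j)) cover≡ℓ (cover-inSegment r (end⇒<λ₀ {r} fr≡1+j)))
  ... | inj₁ cover<ℓ = inj₂ (extra⁺ r<ℓ (to <conj⇔ ℓ<conj) fr≡1+j)
    where
    spread≢0 : spread r ≢ 0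
    spread≢0 spread≡0 =
      <⇒≱ cover<ℓ (subst (ℓ ≤_) (trans (cong (cover r j +_) spread≡0) (+-identityʳ _)) ℓ≤top)
    1+r<conj : suc r < conj r
    1+r<conj = m∸n≢0⇒n<m spread≢0
    cover≡r : cover r j ≡ r
    cover≡r = cover-self (inSegment-last (<-≤-trans (to <conj⇔ 1+r<conj) (ρ-antitone (n≤1+n r))) fr≡1+j)
    r<ℓ : r < ℓ
    r<ℓ = subst (_< ℓ) cover≡r cover<ℓ
    ℓ<conj : ℓ < conj r
    ℓ<conj = begin-strict
      ℓ                     ≤⟨ ℓ≤top ⟩
      cover r j + spread r  ≡⟨ cong (_+ spread r) cover≡r ⟩
      r + spread r          <⟨ n<1+n _ ⟩
      suc r + spread r      ≡⟨ m+[n∸m]≡n (<⇒≤ 1+r<conj) ⟩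
      conj r                ∎
      where open ≤-Reasoning

  colHas⇒inSegment⊎extra : ∀ {ℓ j} → j < λ₀ → T (colHas lam filling ℓ j) →
                           T (inSegment ℓ j) ⊎ T (extra ℓ j)
  colHas⇒inSegment⊎extra {ℓ} {j} j<λ₀ h with colHas⁻ h
  ... | i , lo≤ℓ , ℓ≤hi with box i j
  ...   | aboveEnd _ lo≡ hi≡ = inj₁ (subst (λ c → T (inSegment c j)) cover≡ℓ (cover-inSegment i j<λ₀))
    where
    cover≡ℓ : cover i j ≡ ℓ
    cover≡ℓ = ≤-antisym (subst (_≤ ℓ) lo≡ lo≤ℓ) (subst (ℓ ≤_) hi≡ ℓ≤hi)
  ...   | atEnd fi≡1+j lo≡ hi≡ =
    endBox⇒inSegment⊎extra {i} fi≡1+j (subst (_≤ ℓ) lo≡ lo≤ℓ) (subst (ℓ ≤_) hi≡ ℓ≤hi)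
  ...   | belowEnd {r} _ fr≡1+j lo≡ hi≡ =
    endBox⇒inSegment⊎extra {r} fr≡1+j
      (≤-trans (m≤m+n _ _) (subst (_≤ ℓ) lo≡ lo≤ℓ)) (subst (ℓ ≤_) hi≡ ℓ≤hi)

  colHas≡inSegment∨extra : ∀ {ℓ j} → j < λ₀ → colHas lam filling ℓ j ≡ (inSegment ℓ j ∨ extra ℓ j)
  colHas≡inSegment∨extra j<λ₀ = T-extensional
    (from T-∨ ∘ colHas⇒inSegment⊎extra j<λ₀)
    ([ inSegment⇒colHas , extra⇒colHas ]′ ∘ to T-∨)

  inSegment-extra-disjoint : ∀ {ℓ j} → T (inSegment ℓ j) → ¬ T (extra ℓ j)
  inSegment-extra-disjoint {ℓ} {j} seg e =
    let r , r<ℓ , _ , fr≡1+j = extra⁻ e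
        j<fℓ = inSegment⇒<f seg
    in <⇒≱ (subst (f ℓ <_) fr≡1+j (flatAt-strict lam r<ℓ (≤-<-trans z≤n j<fℓ))) j<fℓ

  ircont-filling : ∀ ℓ → ircont lam filling ℓ ≡ ρ ℓ
  ircont-filling ℓ = begin
    countB (colHas lam filling ℓ) λ₀
      ≡⟨ countB-cong _ _ λ₀ colHas≡inSegment∨extra ⟩
    countB (λ j → inSegment ℓ j ∨ extra ℓ j) λ₀
      ≡⟨ countB-∨ _ _ λ₀ (λ _ → inSegment-extra-disjoint) ⟩
    countB (inSegment ℓ) λ₀ + countB (extra ℓ) λ₀
      ≡⟨ cong₂ _+_ (countB-inSegment ℓ) (countB-extra ℓ) ⟩
    (ρ ℓ ∸ ℓ) + (ℓ ⊓ ρ ℓ)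
      ≡⟨ +-comm (ρ ℓ ∸ ℓ) _ ⟩
    (ℓ ⊓ ρ ℓ) + (ρ ℓ ∸ ℓ)
      ≡⟨ m⊓n+n∸m≡n ℓ (ρ ℓ) ⟩
    ρ ℓ ∎
    where open ≡-Reasoning

  module HighestWeight (m : ℕ) where

    open ColumnSigns (mPure lam filling m) (m1Pure lam filling m)

    F : ℕ
    F = f (suc m)

    extra-suc⇒colHas : ∀ {j} → T (extra (suc m) j) → T (colHas lam filling m j)
    extra-suc⇒colHas e with extra⁻ e
    ... | r , r<1+m , r<ρ , fr≡1+j with m≤n⇒m<n∨m≡n (s≤s⁻¹ r<1+m)
    ...   | inj₁ r<m = extra⇒colHas (extra⁺ r<m (<-≤-trans r<ρ (ρ-antitone (n≤1+n m))) fr≡1+j)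
    ...   | inj₂ refl = inSegment⇒colHas (inSegment-last (<-≤-trans r<ρ (ρ-antitone (n≤1+n m))) fr≡1+j)

    minus⇒inSegment : ∀ {j} → j < λ₀ → T (minusColumn j) → T (inSegment (suc m) j) × j < segStart m
    minus⇒inSegment {j} j<λ₀ mc with m1Pure⇒colHas lam filling m j (minusColumn⇒M mc)
    ... | has-1+m , ¬has-m with colHas⇒inSegment⊎extra j<λ₀ has-1+m
    ...   | inj₂ e = contradiction (extra-suc⇒colHas e) ¬has-m
    ...   | inj₁ seg = seg , ≰⇒> (¬has-m ∘ inSegment⇒colHas ∘ λ segStart≤j → inSegment⁺ segStart≤j j<fm)
      where
      j<fm : j < f m
      j<fm = <-≤-trans (inSegment⇒<f seg) (flatAt-antitone lam (n≤1+n m))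

    plus-range : ∀ {j} → segStart m ⊔ F ≤ j → j < f m ∸ 1 → T (mPure lam filling m j)
    plus-range {j} from≤j j<fm-1 = colHas⇒mPure lam filling m j
      (inSegment⇒colHas (inSegment⁺ (m⊔n≤o⇒m≤o _ _ from≤j) j<fm))
      ([ ¬inSegment , ¬extra ]′ ∘ colHas⇒inSegment⊎extra (<-≤-trans j<fm (flatAt≤head lam m)))
      where
      j<fm : j < f m
      j<fm = <-≤-trans j<fm-1 (m∸n≤m (f m) 1)
      ¬inSegment : ¬ T (inSegment (suc m) j)
      ¬inSegment seg = <⇒≱ (inSegment⇒<f seg) (m⊔n≤o⇒n≤o _ _ from≤j)
      ¬extra : ¬ T (extra (suc m) j)
      ¬extra e = let r , r<1+m , _ , fr≡1+j = extra⁻ e in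
        <⇒≱ j<fm-1 (∸-monoˡ-≤ 1 (subst (f m ≤_) fr≡1+j (flatAt-antitone lam (s≤s⁻¹ r<1+m))))

    own-suc<own : 0 < own (suc m) → own (suc m) < own m
    own-suc<own own>0 = begin-strict
      ρ (suc m) ∸ suc m   <⟨ ∸-monoʳ-< (n<1+n m) (<⇒≤ (m∸n≢0⇒n<m (>⇒≢ own>0))) ⟩
      ρ (suc m) ∸ m       ≤⟨ ∸-monoˡ-≤ m (ρ-antitone (n≤1+n m)) ⟩
      ρ m ∸ m             ∎
      where open ≤-Reasoning

    minus-columns≤plus-columns : 0 < own (suc m) →
      (segStart m ⊓ F) ∸ segStart (suc m) ≤ (f m ∸ 1) ∸ (segStart m ⊔ F)
    minus-columns≤plus-columns own>0 = m+n≤o+p⇒m∸p≤o∸n (s ⊓ F) (s ⊔ F) (f m ∸ 1) s' (begin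
      (s ⊓ F) + (s ⊔ F)       ≡⟨ m⊓n+m⊔n≡m+n s F ⟩
      s + F                   ≡⟨ cong (s +_) (sym (m∸n+n≡m (own≤f (suc m)))) ⟩
      s + (s' + own (suc m))  ≡⟨ cong (s +_) (+-comm s' _) ⟩
      s + (own (suc m) + s')  ≡⟨ sym (+-assoc s _ _) ⟩
      s + own (suc m) + s'    ≤⟨ +-monoˡ-≤ s' (∸-monoˡ-≤ 1 below-fm) ⟩
      (f m ∸ 1) + s'          ∎)
      where
      open ≤-Reasoning
      s = segStart m
      s' = segStart (suc m)
      below-fm : suc (s + own (suc m)) ≤ f m
      below-fm = begin
        suc (s + own (suc m))   ≡⟨ sym (+-suc s _) ⟩
        s + suc (own (suc m))   ≤⟨ +-monoʳ-≤ s (own-suc<own own>0) ⟩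
        s + own m               ≡⟨ m∸n+n≡m (own≤f m) ⟩
        f m                     ∎

    minusCount≤plusCount : countB minusColumn F ≤ countB (plusColumnFrom F) λ₀
    minusCount≤plusCount with own (suc m) ≟ 0
    ... | yes own≡0 = ≤-trans (≤-reflexive (countB-none _ F noMinus)) z≤n
      where
      noMinus : ∀ {j} → j < F → ¬ T (minusColumn j)
      noMinus {j} j<F mc =
        let seg , _ = minus⇒inSegment (<-≤-trans j<F (flatAt≤head lam (suc m))) mc
        in <⇒≱ j<F (subst (_≤ j) (cong (F ∸_) own≡0) (inSegment⇒segStart≤ seg))
    ... | no own≢0 = begin
      countB minusColumn F
        ≤⟨ countB-mono _ _ F minus∈interval ⟩
      countB (λ j → (segStart (suc m) ≤ᵇ j) ∧ (j <ᵇ segStart m ⊓ F)) F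
        ≡⟨ countB-interval≤ (segStart (suc m)) (m⊓n≤n (segStart m) F) ⟩
      (segStart m ⊓ F) ∸ segStart (suc m)
        ≤⟨ minus-columns≤plus-columns (n≢0⇒n>0 own≢0) ⟩
      (f m ∸ 1) ∸ (segStart m ⊔ F)
        ≡⟨ sym (countB-interval≤ (segStart m ⊔ F) (≤-trans (m∸n≤m (f m) 1) (flatAt≤head lam m))) ⟩
      countB (λ j → (segStart m ⊔ F ≤ᵇ j) ∧ (j <ᵇ f m ∸ 1)) λ₀
        ≤⟨ countB-mono _ _ λ₀ interval⇒plus ⟩
      countB (plusColumnFrom F) λ₀ ∎
      where
      open ≤-Reasoning
      minus∈interval : ∀ {j} → j < F → T (minusColumn j) →
                       T ((segStart (suc m) ≤ᵇ j) ∧ (j <ᵇ segStart m ⊓ F))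
      minus∈interval {j} j<F mc =
        let seg , j<segStart = minus⇒inSegment (<-≤-trans j<F (flatAt≤head lam (suc m))) mc
        in from T-∧ (≤⇒≤ᵇ (inSegment⇒segStart≤ seg) , <⇒<ᵇ (⊓-glb j<segStart j<F))
      interval⇒plus : ∀ {j} → j < λ₀ → T ((segStart m ⊔ F ≤ᵇ j) ∧ (j <ᵇ f m ∸ 1)) →
                      T (plusColumnFrom F j)
      interval⇒plus {j} _ range =
        let from≤j , j<fm-1 = to (T-∧ {segStart m ⊔ F ≤ᵇ j}) range
            from≤j' = ≤ᵇ⇒≤ (segStart m ⊔ F) j from≤j
        in from (T-∧ {F ≤ᵇ j})
             (≤⇒≤ᵇ (m⊔n≤o⇒n≤o (segStart m) F from≤j') , plus-range from≤j' (<ᵇ⇒< j _ j<fm-1))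

    signature-pending≡0 : pendingUpTo λ₀ ≡ 0
    signature-pending≡0 = pendingUpTo≡0 (flatAt≤head lam (suc m)) noMinus minusCount≤plusCount
      where
      noMinus : ∀ {j} → F ≤ j → j < λ₀ → ¬ T (minusColumn j)
      noMinus F≤j j<λ₀ mc = <⇒≱ (inSegment⇒<f (proj₁ (minus⇒inSegment j<λ₀ mc))) F≤j

  filling-isHighestWeight : IsHighestWeight n lam filling
  filling-isHighestWeight m _ = pending≡0⇒minus∉ (HighestWeight.signature-pending≡0 m)

lemma4p5 : (n : ℕ) → 1 ≤ n → (lam rho : List ℕ) → IsPartition lam → IsPartition rho →
    ((lam ‼ 0) ∷ []) ⊆P rho → rho ⊆P bar n lam →
    Σ (Filling n) (λ T → IsSVRPP n lam T × IsHighestWeight n lam T ×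
      (∀ k → k < n → ircont lam T k ≡ rho ‼ k))
lemma4p5 n _ lam rho isPartition-lam isPartition-rho head⊆rho rho⊆bar =
  filling , filling-isSVRPP , filling-isHighestWeight , λ k _ → ircont-filling k
  where open Construction n isPartition-lam isPartition-rho (head⊆rho 0) rho⊆bar
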